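{- For every $n\ge1$, the number $d_n$ of $f\in F_n^{\nearrow}$ with no fixed points other than $1$ (i.e. $f_i\ne i$ for all $2\le i\le n$) such that $\phi(f)$ avoids the pattern $132$ equals the number of integer partitions of $n-1$.
   Context: $[n]=\{1,\dots,n\}$, $\mathfrak{S}_n$ the symmetric group on $[n]$; products of permutations are composed with the leftmost factor acting first: $(\alpha\beta)(x)=\beta(\alpha(x))$. A function $f:[n]\to[n]$ is subexceedant if $1\le f(i)\le i$ for all $i$, written $f_1\cdots f_n$; $F_n^{\nearrow}$ is the set of non-decreasing subexceedant functions on $[n]$. $\phi(f)=(1,f_1)(2,f_2)\cdots(n,f_n)\in\mathfrak{S}_n$ (with $(i,i)$ the identity). A permutation $\sigma$ contains the pattern $132$ if there are $a<b<c$ with $\sigma(a)<\sigma(c)<\sigma(b)$, and avoids it otherwise. -}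

module Defs where

open import Data.Nat using (ℕ; zero; suc; _+_; _≤_; _<_; _≡ᵇ_)
open import Data.Bool using (if_then_else_)
open import Data.Fin using (Fin; toℕ)
open import Data.Vec using (Vec; lookup; toList)
open import Data.List using (List; []; _∷_; length; upTo; zip; map)
open import Data.Nat.ListAction using (sum)
open import Data.List.Relation.Unary.All using (All)
open import Data.List.Relation.Unary.Linked using (Linked)
open import Data.List.Relation.Unary.Unique.Propositional using (Unique)
open import Data.List.Membership.Propositional using (_∈_)
open import Data.Product using (Σ; _×_; _,_)
open import Function.Bundles using (_⇔_)
open import Relation.Nullary using (¬_)
open import Relation.Binary.PropositionalEquality using (_≡_; _≢_)

-- Counting: "the number of x : A with P x is k" means there is a
-- duplicate-free list enumerating exactly the x with P x, of length k.

HasCount : {A : Set} → (A → Set) → ℕ → Set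
HasCount {A} P k =
  Σ (List A) λ L → Unique L × (∀ x → (x ∈ L) ⇔ P x) × length L ≡ k

-- Functions [n] → [n] are encoded as vectors f : Vec ℕ n, with
-- lookup f i = f_(toℕ i + 1).  Values are natural numbers (elements of [n]).

Subexceedant : {n : ℕ} → Vec ℕ n → Set
Subexceedant {n} f = ∀ (i : Fin n) → 1 ≤ lookup f i × lookup f i ≤ suc (toℕ i)

NonDecreasing : {n : ℕ} → Vec ℕ n → Set
NonDecreasing {n} f = ∀ (i j : Fin n) → toℕ i ≤ toℕ j → lookup f i ≤ lookup f j

NoFixedPointsExceptOne : {n : ℕ} → Vec ℕ n → Set
NoFixedPointsExceptOne {n} f = ∀ (i : Fin n) → 1 ≤ toℕ i → lookup f i ≢ suc (toℕ i)

swap : ℕ → ℕ → ℕ → ℕ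
swap a b x = if x ≡ᵇ a then b else (if x ≡ᵇ b then a else x)

applySwaps : List (ℕ × ℕ) → ℕ → ℕ
applySwaps [] x = x
applySwaps ((a , b) ∷ r) x = applySwaps r (swap a b x)

-- φ(f) = (1,f_1)(2,f_2)⋯(n,f_n), leftmost factor acting first
φ : {n : ℕ} → Vec ℕ n → ℕ → ℕ
φ {n} f = applySwaps (zip (map suc (upTo n)) (toList f))

Contains132 : ℕ → (ℕ → ℕ) → Set
Contains132 n σ =
  Σ ℕ λ a → Σ ℕ λ b → Σ ℕ λ c →
    1 ≤ a × a < b × b < c × c ≤ n × σ a < σ c × σ c < σ b

Avoids132 : ℕ → (ℕ → ℕ) → Set
Avoids132 n σ = ¬ Contains132 n σ

IsD : (n : ℕ) → Vec ℕ n → Set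
IsD n f = Subexceedant f × NonDecreasing f × NoFixedPointsExceptOne f
          × Avoids132 n (φ f)

IsPartition : ℕ → List ℕ → Set
IsPartition m λs = Linked (λ x y → y ≤ x) λs × All (λ x → 1 ≤ x) λs × sum λs ≡ m

module Submission where

-- Since f₂ ≠ 2 forces f₁ = f₂ = 1, one builds φ(f) one transposition at a time. As long as no 132
-- has appeared, the permutation of [i] obtained after the i-th factor has the rigid form described
-- by Shape, determined by f_i = t and two further parameters r, d. Of the values f_{i+1} ≥ f_i
-- only t+d+1, t+1 (if d > 0) and 1 (if t = 1, d = 0) keep it 132-avoiding; any other value creates
-- a 132 whose "2" is the new value f_{i+1}, and such an occurrence survives all later factors since
-- they only move values ≥ f_{i+1}. Hence the admissible continuations of length m are counted by
-- the recursion that splits the partitions of 1+r+m with first part in [1+r, 1+r+d] according to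
-- whether the first part is 1+r (for t = 1, all partitions with first part ≥ 1+r); starting from
-- φ(11) = 21, where t = 1 and r = d = 0, this counts the partitions of n−1.

open import Defs
open import Data.Bool using (true; false; T)
open import Data.Empty using (⊥; ⊥-elim)
open import Data.Fin using (toℕ) renaming (zero to fzero; suc to fsuc)
open import Data.List as L using (List; []; _∷_; _++_; applyUpTo; zip)
import Data.List.Properties as List
open import Data.List.Membership.Propositional using (_∈_)
open import Data.List.Membership.Propositional.Properties
  using (∈-map⁺; ∈-map⁻; ∈-++⁺ˡ; ∈-++⁺ʳ; ∈-++⁻; map∷-decomp∈; []∉map∷)
open import Data.List.Relation.Unary.All as All using (All)
open import Data.List.Relation.Unary.AllPairs using ([]; _∷_)
open import Data.List.Relation.Unary.Any using (here)
open import Data.List.Relation.Unary.Linked as Linked using (Linked; [-])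
open import Data.List.Relation.Unary.Unique.Propositional using (Unique)
open import Data.List.Relation.Unary.Unique.Propositional.Properties using (++⁺; map⁺)
open import Data.Nat
open import Data.Nat.ListAction using (sum)
open import Data.Nat.Properties
open import Data.Nat.Tactic.RingSolver using (solve-∀)
open import Data.Product using (Σ; _×_; _,_; proj₁; proj₂)
open import Data.Sum using (_⊎_; inj₁; inj₂)
open import Data.Unit using (⊤; tt)
open import Data.Vec using (Vec; []; _∷_; toList; lookup)
open import Data.Vec.Properties using (∷-injective; ∷-injectiveʳ)
open import Function using (id; _∘_)
open import Function.Bundles using (mk⇔)
open import Relation.Nullary using (¬_; Dec; yes; no)
open import Relation.Binary.PropositionalEquality

≡ᵇ-refl : ∀ n → (n ≡ᵇ n) ≡ true
≡ᵇ-refl zero    = refl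
≡ᵇ-refl (suc n) = ≡ᵇ-refl n

≢⇒≡ᵇ-false : ∀ {m n} → m ≢ n → (m ≡ᵇ n) ≡ false
≢⇒≡ᵇ-false {m} {n} m≢n with m ≡ᵇ n in eq
... | false = refl
... | true  = ⊥-elim (m≢n (≡ᵇ⇒≡ m n (subst T (sym eq) tt)))

swap-left : ∀ a b → swap a b a ≡ b
swap-left a b rewrite ≡ᵇ-refl a = refl

swap-right : ∀ {a b} → b ≢ a → swap a b b ≡ a
swap-right {a} {b} b≢a rewrite ≢⇒≡ᵇ-false b≢a | ≡ᵇ-refl b = refl

swap-other : ∀ {a b x} → x ≢ a → x ≢ b → swap a b x ≡ x
swap-other x≢a x≢b rewrite ≢⇒≡ᵇ-false x≢a | ≢⇒≡ᵇ-false x≢b = refl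

extend : ℕ → ℕ → (ℕ → ℕ) → ℕ → ℕ
extend i v g x = swap (suc i) v (g x)

record Confined (i : ℕ) (g : ℕ → ℕ) : Set where
  field
    bounded : ∀ {x} → 1 ≤ x → x ≤ i → g x ≤ i
    fixed   : ∀ {x} → i < x → g x ≡ x

module _ {i g} (cf : Confined i g) where
  open Confined cf

  private
    ≢new : ∀ {x} → 1 ≤ x → x ≤ i → g x ≢ suc i
    ≢new 1≤x x≤i gx≡ = 1+n≰n (subst (_≤ i) gx≡ (bounded 1≤x x≤i))

  extend-hit : ∀ {v x} → 1 ≤ x → x ≤ i → g x ≡ v → extend i v g x ≡ suc i
  extend-hit 1≤x x≤i refl = swap-right (≢new 1≤x x≤i)

  extend-miss : ∀ {v x} → 1 ≤ x → x ≤ i → g x ≢ v → extend i v g x ≡ g x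
  extend-miss 1≤x x≤i gx≢v = swap-other (≢new 1≤x x≤i) gx≢v

  extend-≤ : ∀ v {x} → 1 ≤ x → x ≤ i → extend i v g x ≤ suc i
  extend-≤ v {x} 1≤x x≤i with g x ≟ v
  ... | yes gx≡v = ≤-reflexive (extend-hit 1≤x x≤i gx≡v)
  ... | no  gx≢v = subst (_≤ suc i) (sym (extend-miss 1≤x x≤i gx≢v)) (m≤n⇒m≤1+n (bounded 1≤x x≤i))

  extend-new : ∀ v → extend i v g (suc i) ≡ v
  extend-new v rewrite fixed (n<1+n i) = swap-left (suc i) v

  extend-confined : ∀ {v} → v ≤ i → Confined (suc i) (extend i v g)
  extend-confined {v} v≤i = record { bounded = bounded′ ; fixed = fixed′ }
    where
    bounded′ : ∀ {x} → 1 ≤ x → x ≤ suc i → extend i v g x ≤ suc i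
    bounded′ 1≤x x≤1+i with m≤n⇒m<n∨m≡n x≤1+i
    ... | inj₁ (s≤s x≤i) = extend-≤ v 1≤x x≤i
    ... | inj₂ refl      = subst (_≤ suc i) (sym (extend-new v)) (m≤n⇒m≤1+n v≤i)
    fixed′ : ∀ {x} → suc i < x → extend i v g x ≡ x
    fixed′ {x} 1+i<x rewrite fixed (<-trans (n<1+n i) 1+i<x) =
      swap-other (>⇒≢ 1+i<x) (>⇒≢ (<-trans (s≤s v≤i) 1+i<x))

record SafeMove (i v : ℕ) (g : ℕ → ℕ) : Set where
  field
    larger-before    : ∀ {x b} → 1 ≤ x → x < b → b ≤ i → g b ≡ v → v < g x
    no-straddle      : ∀ {x y} → 1 ≤ x → x < y → y ≤ i → g x < v → v < g y → ⊥
    no-ascent-around : ∀ {x b y} → 1 ≤ x → x < b → b < y → y ≤ i → g b ≡ v → g x < g y → ⊥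

module _ {i v g} (cf : Confined i g) (v≤i : v ≤ i) (safe : SafeMove i v g) where
  open SafeMove safe
  private
    h = extend i v g

    new-not-last : ∀ {a b} → 1 ≤ a → a < b → b ≤ i → h a < h (suc i) → h (suc i) < h b → ⊥
    new-not-last {a} {b} 1≤a a<b b≤i ha<v v<hb
      rewrite extend-new cf v with g a ≟ v
    ... | yes ga≡v = <-asym (subst (_< v) (extend-hit cf 1≤a a≤i ga≡v) ha<v) (s≤s v≤i)
      where a≤i = ≤-trans (<⇒≤ a<b) b≤i
    ... | no ga≢v with g b ≟ v
    ...   | yes gb≡v = <-asym (larger-before 1≤a a<b b≤i gb≡v) ga<v
      where ga<v = subst (_< v) (extend-miss cf 1≤a (≤-trans (<⇒≤ a<b) b≤i) ga≢v) ha<v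
    ...   | no gb≢v = no-straddle 1≤a a<b b≤i
                        (subst (_< v) (extend-miss cf 1≤a (≤-trans (<⇒≤ a<b) b≤i) ga≢v) ha<v)
                        (subst (v <_) (extend-miss cf (≤-trans 1≤a (<⇒≤ a<b)) b≤i gb≢v) v<hb)

    old-last : ∀ {a b c} → 1 ≤ a → a < b → b < c → c ≤ i → h a < h c → h c < h b →
               Avoids132 i g → ⊥
    old-last {a} {b} {c} 1≤a a<b b<c c≤i hac hcb av = cases (g c ≟ v) (g a ≟ v) (g b ≟ v)
      where
      1≤b = ≤-trans 1≤a (<⇒≤ a<b)
      1≤c = ≤-trans 1≤b (<⇒≤ b<c)
      b≤i = ≤-trans (<⇒≤ b<c) c≤i
      a≤i = ≤-trans (<⇒≤ a<b) b≤i
      ga<gc : g a ≢ v → g c ≢ v → g a < g c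
      ga<gc ga≢v gc≢v = subst₂ _<_ (extend-miss cf 1≤a a≤i ga≢v) (extend-miss cf 1≤c c≤i gc≢v) hac
      cases : Dec (g c ≡ v) → Dec (g a ≡ v) → Dec (g b ≡ v) → ⊥
      cases (yes gc≡v) _ _ =
        <-irrefl refl (<-≤-trans (subst (_< h b) (extend-hit cf 1≤c c≤i gc≡v) hcb) (extend-≤ cf v 1≤b b≤i))
      cases (no _) (yes ga≡v) _ =
        <-irrefl refl (<-≤-trans (subst (_< h c) (extend-hit cf 1≤a a≤i ga≡v) hac) (extend-≤ cf v 1≤c c≤i))
      cases (no gc≢v) (no ga≢v) (yes gb≡v) = no-ascent-around 1≤a a<b b<c c≤i gb≡v (ga<gc ga≢v gc≢v)
      cases (no gc≢v) (no ga≢v) (no gb≢v) =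
        av (a , b , c , 1≤a , a<b , b<c , c≤i , ga<gc ga≢v gc≢v ,
            subst₂ _<_ (extend-miss cf 1≤c c≤i gc≢v) (extend-miss cf 1≤b b≤i gb≢v) hcb)

  extend-avoids : Avoids132 i g → Avoids132 (suc i) h
  extend-avoids av (a , b , c , 1≤a , a<b , b<c , c≤1+i , hac , hcb) with m≤n⇒m<n∨m≡n c≤1+i
  ... | inj₂ refl      = new-not-last 1≤a a<b (≤-pred b<c) hac hcb
  ... | inj₁ (s≤s c≤i) = old-last 1≤a a<b b<c c≤i hac hcb av

Occurs132Below : ℕ → (ℕ → ℕ) → ℕ → Set
Occurs132Below i g w = Σ ℕ λ a → Σ ℕ λ b → Σ ℕ λ c →
  1 ≤ a × a < b × b < c × c ≤ i × g a < g c × g c < g b × g c ≤ w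

-- If c carries v, the new position i+1 takes over its value; otherwise nothing of a, b, c moves down.
extend-keeps-132 : ∀ {i v w g} → Confined i g → v ≤ i → w ≤ v →
                   Occurs132Below i g w → Occurs132Below (suc i) (extend i v g) v
extend-keeps-132 {i} {v} {w} {g} cf v≤i w≤v (a , b , c , 1≤a , a<b , b<c , c≤i , gac , gcb , gc≤w)
  with g c ≟ v
... | yes gc≡v =
  a , b , suc i , 1≤a , a<b , s≤s b≤i , ≤-refl ,
  subst₂ _<_ (sym ha) (sym hnew) (subst (g a <_) gc≡v gac) ,
  subst₂ _<_ (sym hnew) (sym hb) (subst (_< g b) gc≡v gcb) ,
  ≤-reflexive hnew
  where
  b≤i = ≤-trans (<⇒≤ b<c) c≤i
  hnew = extend-new cf v
  ha = extend-miss cf 1≤a (≤-trans (<⇒≤ a<b) b≤i) (λ ga≡v → <-irrefl (trans ga≡v (sym gc≡v)) gac)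
  hb = extend-miss cf (≤-trans 1≤a (<⇒≤ a<b)) b≤i (λ gb≡v → <-irrefl (trans gc≡v (sym gb≡v)) gcb)
... | no gc≢v =
  a , b , c , 1≤a , a<b , b<c , m≤n⇒m≤1+n c≤i ,
  subst₂ _<_ (sym ha) (sym hc) gac , hcb , subst (_≤ v) (sym hc) gc≤v
  where
  1≤b = ≤-trans 1≤a (<⇒≤ a<b)
  b≤i = ≤-trans (<⇒≤ b<c) c≤i
  gc≤v = ≤-trans gc≤w w≤v
  hc = extend-miss cf (≤-trans 1≤b (<⇒≤ b<c)) c≤i gc≢v
  ha = extend-miss cf 1≤a (≤-trans (<⇒≤ a<b) b≤i) (λ ga≡v → <⇒≱ (subst (_< g c) ga≡v gac) gc≤v)
  hcb : extend i v g c < extend i v g b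
  hcb with g b ≟ v
  ... | yes gb≡v = subst₂ _<_ (sym hc) (sym (extend-hit cf 1≤b b≤i gb≡v))
                     (s≤s (Confined.bounded cf (≤-trans 1≤b (<⇒≤ b<c)) c≤i))
  ... | no gb≢v  = subst₂ _<_ (sym hc) (sym (extend-miss cf 1≤b b≤i gb≢v)) gcb

swapsFrom : ℕ → List ℕ → List (ℕ × ℕ)
swapsFrom i []       = []
swapsFrom i (v ∷ vs) = (i , v) ∷ swapsFrom (suc i) vs

extendBy : ∀ {m} → ℕ → Vec ℕ m → (ℕ → ℕ) → ℕ → ℕ
extendBy i s g x = applySwaps (swapsFrom (suc i) (toList s)) (g x)

ValidSuffix : ∀ {m} → ℕ → ℕ → Vec ℕ m → Set
ValidSuffix i w []      = ⊤
ValidSuffix i w (v ∷ s) = w ≤ v × v ≤ i × ValidSuffix (suc i) v s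

132-persists : ∀ {m i w g} (s : Vec ℕ m) → Confined i g → ValidSuffix i w s →
               Occurs132Below i g w → Contains132 (i + m) (extendBy i s g)
132-persists {i = i} [] cf _ (a , b , c , 1≤a , a<b , b<c , c≤i , gac , gcb , _) =
  a , b , c , 1≤a , a<b , b<c , subst (c ≤_) (sym (+-identityʳ i)) c≤i , gac , gcb
132-persists {suc m} {i} {g = g} (v ∷ s) cf (w≤v , v≤i , valid) occ =
  subst (λ k → Contains132 k (extendBy (suc i) s (extend i v g))) (sym (+-suc i m))
    (132-persists s (extend-confined cf v≤i) valid (extend-keeps-132 cf v≤i w≤v occ))

-- After the i-th factor of φ(f), where t = f_i, the one-line notation of the permutation on [i] reads
--   t+d+1, t+d+2, …, t+d+r+1 | t+1, t+2, …, t+d | values ≤ t, ending with t and including 1.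
record Shape (i t r d : ℕ) (g : ℕ → ℕ) : Set where
  field
    size      : i ≡ t + suc r + d
    1≤t       : 1 ≤ t
    t≡1⇒d≡0   : t ≡ 1 → d ≡ 0
    ascending : ∀ {x} → 1 ≤ x → x ≤ suc r → g x ≡ t + d + x
    middle    : ∀ {y} → 1 ≤ y → y ≤ d → g (suc r + y) ≡ t + y
    low       : ∀ {x} → suc r + d < x → x ≤ i → g x ≤ t
    last      : g i ≡ t
    has-one   : Σ ℕ λ q → suc r + d < q × q ≤ i × g q ≡ 1
    confined  : Confined i g
    avoids    : Avoids132 i g

Region : (t r d : ℕ) → (ℕ → ℕ) → ℕ → Set
Region t r d g x = (x ≤ suc r × g x ≡ t + d + x)
                 ⊎ (Σ ℕ λ y → 1 ≤ y × y ≤ d × x ≡ suc r + y × g x ≡ t + y)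
                 ⊎ (suc r + d < x × g x ≤ t)

region : ∀ {i t r d g x} → Shape i t r d g → 1 ≤ x → x ≤ i → Region t r d g x
region {t = t} {r} {d} {g} {x} S 1≤x x≤i with x ≤? suc r
... | yes x≤1+r = inj₁ (x≤1+r , Shape.ascending S 1≤x x≤1+r)
... | no  x≰1+r with m≤n⇒∃[o]m+o≡n (<⇒≤ (≰⇒> x≰1+r))
...   | zero , e = ⊥-elim (x≰1+r (≤-reflexive (trans (sym e) (+-identityʳ (suc r)))))
...   | suc y′ , refl with suc y′ ≤? d
...     | yes y≤d = inj₂ (inj₁ (suc y′ , s≤s z≤n , y≤d , refl , Shape.middle S (s≤s z≤n) y≤d))
...     | no  y≰d = inj₂ (inj₂ (1+r+d<x , Shape.low S 1+r+d<x x≤i))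
  where 1+r+d<x = +-monoʳ-< (suc r) (≰⇒> y≰d)

-- f_{i+1} = t+d+1 = g 1: the first ascending run becomes the middle block.
module TopMove {i t r d g} (S : Shape i t r d g) where
  open Shape S
  open Confined confined

  v : ℕ
  v = suc (t + d)

  h : ℕ → ℕ
  h = extend i v g

  v≤i : v ≤ i
  v≤i = subst (v ≤_) (sym (trans size (regroup t r d))) (m≤m+n v r)
    where regroup : ∀ t r d → t + suc r + d ≡ suc (t + d) + r
          regroup = solve-∀

  g1≡v : g 1 ≡ v
  g1≡v = trans (ascending ≤-refl (s≤s z≤n)) (+-comm (t + d) 1)

  v≢1 : v ≢ 1
  v≢1 v≡1 = <⇒≱ 1≤t (≤-reflexive (m+n≡0⇒m≡0 t (suc-injective v≡1)))

  beyond-first≤t+d : ∀ {x} → suc r < x → x ≤ i → g x ≤ t + d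
  beyond-first≤t+d 1+r<x x≤i with region S (≤-trans (s≤s z≤n) (<⇒≤ 1+r<x)) x≤i
  ... | inj₁ (x≤1+r , _)                   = ⊥-elim (<⇒≱ 1+r<x x≤1+r)
  ... | inj₂ (inj₁ (y , _ , y≤d , _ , gx)) = subst (_≤ t + d) (sym gx) (+-monoʳ-≤ t y≤d)
  ... | inj₂ (inj₂ (_ , gx≤t))             = m≤n⇒m≤n+o d gx≤t

  preimage-of-v : ∀ {b} → 1 ≤ b → b ≤ i → g b ≡ v → b ≡ 1
  preimage-of-v {b} 1≤b b≤i gb≡v with region S 1≤b b≤i
  ... | inj₁ (_ , gb) = +-cancelˡ-≡ (t + d) b 1 (trans (sym gb) (trans gb≡v (+-comm 1 (t + d))))
  ... | inj₂ (inj₁ (y , _ , y≤d , _ , gb)) = ⊥-elim (<⇒≱ (s≤s (+-monoʳ-≤ t y≤d)) (≤-reflexive (trans (sym gb≡v) gb)))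
  ... | inj₂ (inj₂ (_ , gb≤t)) = ⊥-elim (<⇒≱ (s≤s (m≤m+n t d)) (subst (_≤ t) gb≡v gb≤t))

  not-after-one : ∀ {x b} → 1 ≤ x → x < b → b ≤ i → g b ≢ v
  not-after-one {x} 1≤x x<b b≤i gb≡v =
    <⇒≱ x<b (subst (_≤ x) (sym (preimage-of-v (≤-trans 1≤x (<⇒≤ x<b)) b≤i gb≡v)) 1≤x)

  no-straddle : ∀ {x y} → 1 ≤ x → x < y → y ≤ i → g x < v → v < g y → ⊥
  no-straddle {x} {y} 1≤x x<y y≤i gx<v v<gy with region S (≤-trans 1≤x (<⇒≤ x<y)) y≤i
  ... | inj₁ (y≤1+r , _) =
        <⇒≱ gx<v (subst (v ≤_) (sym (ascending 1≤x (≤-trans (<⇒≤ x<y) y≤1+r)))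
                   (subst (_≤ t + d + x) (+-comm (t + d) 1) (+-monoʳ-≤ (t + d) 1≤x)))
  ... | inj₂ (inj₁ (_ , _ , y′≤d , _ , gy)) = <⇒≱ v<gy (subst (_≤ v) (sym gy) (m≤n⇒m≤1+n (+-monoʳ-≤ t y′≤d)))
  ... | inj₂ (inj₂ (_ , gy≤t)) = <⇒≱ v<gy (m≤n⇒m≤1+n (m≤n⇒m≤n+o d gy≤t))

  safe : SafeMove i v g
  safe = record
    { larger-before    = λ 1≤x x<b b≤i gb≡v → ⊥-elim (not-after-one 1≤x x<b b≤i gb≡v)
    ; no-straddle      = no-straddle
    ; no-ascent-around = λ 1≤x x<b b<y y≤i gb≡v _ → not-after-one 1≤x x<b (≤-trans (<⇒≤ b<y) y≤i) gb≡v
    }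

  ascending′ : ∀ {x} → 1 ≤ x → x ≤ 1 → h x ≡ v + r + x
  ascending′ (s≤s z≤n) (s≤s z≤n) = trans (extend-hit confined ≤-refl (≤-trans (s≤s z≤n) v≤i) g1≡v)
                                         (trans (cong suc size) (regroup t r d))
    where regroup : ∀ t r d → suc (t + suc r + d) ≡ suc (t + d) + r + 1
          regroup = solve-∀

  middle′ : ∀ {y} → 1 ≤ y → y ≤ r → h (suc y) ≡ v + y
  middle′ {y} 1≤y y≤r = trans (extend-miss confined (s≤s z≤n) 1+y≤i gy≢v) (trans gy (regroup t d y))
    where
    regroup : ∀ t d y → t + d + suc y ≡ suc (t + d) + y
    regroup = solve-∀
    1+y≤i : suc y ≤ i
    1+y≤i = subst (suc y ≤_) (sym size) (≤-trans (s≤s y≤r) (≤-trans (m≤n+m (suc r) t) (m≤m+n _ d)))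
    gy : g (suc y) ≡ t + d + suc y
    gy = ascending (s≤s z≤n) (s≤s y≤r)
    gy≢v : g (suc y) ≢ v
    gy≢v gy≡v = <⇒≱ (subst (v <_) (trans (sym (regroup t d y)) (sym gy)) (s≤s (m<m+n (t + d) 1≤y)))
                     (≤-reflexive gy≡v)

  low′ : ∀ {x} → suc r < x → x ≤ suc i → h x ≤ v
  low′ {x} 1+r<x x≤1+i with m≤n⇒m<n∨m≡n x≤1+i
  ... | inj₂ refl = ≤-reflexive (extend-new confined v)
  ... | inj₁ (s≤s x≤i) with g x ≟ v
  ...   | yes gx≡v = ⊥-elim (<⇒≱ 1+r<x (subst (_≤ suc r) (sym (preimage-of-v 1≤x x≤i gx≡v)) (s≤s z≤n)))
    where 1≤x = ≤-trans (s≤s z≤n) (<⇒≤ 1+r<x)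
  ...   | no gx≢v = subst (_≤ v) (sym (extend-miss confined (≤-trans (s≤s z≤n) (<⇒≤ 1+r<x)) x≤i gx≢v))
                      (m≤n⇒m≤1+n (beyond-first≤t+d 1+r<x x≤i))

  has-one′ : Σ ℕ λ q → suc r < q × q ≤ suc i × h q ≡ 1
  has-one′ with has-one
  ... | q , 1+r+d<q , q≤i , gq≡1 =
    q , <-≤-trans (s≤s (m≤m+n (suc r) d)) 1+r+d<q , m≤n⇒m≤1+n q≤i ,
    trans (extend-miss confined (≤-trans (s≤s z≤n) (<⇒≤ 1+r+d<q)) q≤i (λ gq≡v → v≢1 (trans (sym gq≡v) gq≡1))) gq≡1

  shape : Shape (suc i) v 0 r h
  shape = record
    { size      = trans (cong suc size) (regroup t r d)
    ; 1≤t       = s≤s z≤n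
    ; t≡1⇒d≡0   = λ v≡1 → ⊥-elim (v≢1 v≡1)
    ; ascending = ascending′
    ; middle    = middle′
    ; low       = low′
    ; last      = extend-new confined v
    ; has-one   = has-one′
    ; confined  = extend-confined confined v≤i
    ; avoids    = extend-avoids confined v≤i safe avoids
    }
    where regroup : ∀ t r d → suc (t + suc r + d) ≡ suc (t + d) + 1 + r
          regroup = solve-∀

-- f_{i+1} = t+1, the first entry of a non-empty middle block, which joins the ascending run.
module ShiftMove {i t r d′ g} (S : Shape i t r (suc d′) g) where
  open Shape S
  open Confined confined

  d v : ℕ
  d = suc d′
  v = suc t

  h : ℕ → ℕ
  h = extend i v g

  v≤i : v ≤ i
  v≤i = subst (v ≤_) (sym size)
          (≤-trans (subst (_≤ t + suc r) (+-comm t 1) (+-monoʳ-≤ t (s≤s z≤n))) (m≤m+n _ d))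

  2+r≤i : suc (suc r) ≤ i
  2+r≤i = subst (suc (suc r) ≤_) (sym (trans size (+-assoc t (suc r) d)))
            (m≤n⇒m≤o+n t (subst (_≤ suc r + d) (+-comm (suc r) 1) (+-monoʳ-≤ (suc r) (s≤s z≤n))))

  g[2+r]≡v : g (suc (suc r)) ≡ v
  g[2+r]≡v = subst (λ z → g z ≡ v) (+-comm (suc r) 1) (trans (middle ≤-refl (s≤s z≤n)) (+-comm t 1))

  v≢1 : v ≢ 1
  v≢1 v≡1 = <⇒≱ 1≤t (≤-reflexive (suc-injective v≡1))

  t+d<ascending : ∀ {x} → 1 ≤ x → x ≤ suc r → t + d < g x
  t+d<ascending 1≤x x≤1+r = subst (t + d <_) (sym (ascending 1≤x x≤1+r)) (m<m+n (t + d) 1≤x)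

  v<ascending : ∀ {x} → 1 ≤ x → x ≤ suc r → v < g x
  v<ascending 1≤x x≤1+r =
    ≤-<-trans (subst (v ≤_) (sym (+-suc t d′)) (s≤s (m≤m+n t d′))) (t+d<ascending 1≤x x≤1+r)

  preimage-of-v : ∀ {b} → 1 ≤ b → b ≤ i → g b ≡ v → b ≡ suc (suc r)
  preimage-of-v {b} 1≤b b≤i gb≡v with region S 1≤b b≤i
  ... | inj₁ (b≤1+r , _) = ⊥-elim (<-irrefl (sym gb≡v) (v<ascending 1≤b b≤1+r))
  ... | inj₂ (inj₁ (y , _ , _ , refl , gb)) =
        trans (cong (suc r +_) (+-cancelˡ-≡ t y 1 (trans (sym gb) (trans gb≡v (+-comm 1 t)))))
              (+-comm (suc r) 1)
  ... | inj₂ (inj₂ (_ , gb≤t)) = ⊥-elim (<⇒≱ ≤-refl (subst (_≤ t) gb≡v gb≤t))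

  larger-before : ∀ {x b} → 1 ≤ x → x < b → b ≤ i → g b ≡ v → v < g x
  larger-before {x} 1≤x x<b b≤i gb≡v with preimage-of-v (≤-trans 1≤x (<⇒≤ x<b)) b≤i gb≡v
  ... | refl = v<ascending 1≤x (≤-pred x<b)

  no-straddle : ∀ {x y} → 1 ≤ x → x < y → y ≤ i → g x < v → v < g y → ⊥
  no-straddle {x} {y} 1≤x x<y y≤i gx<v v<gy with region S 1≤x (≤-trans (<⇒≤ x<y) y≤i)
  ... | inj₁ (x≤1+r , _) = <⇒≱ gx<v (<⇒≤ (v<ascending 1≤x x≤1+r))
  ... | inj₂ (inj₁ (z , 1≤z , _ , _ , gx)) =
        <⇒≱ gx<v (subst (v ≤_) (sym gx) (subst (_≤ t + z) (+-comm t 1) (+-monoʳ-≤ t 1≤z)))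
  ... | inj₂ (inj₂ (1+r+d<x , _)) = <⇒≱ v<gy (m≤n⇒m≤1+n (low (<-trans 1+r+d<x x<y) y≤i))

  no-ascent-around : ∀ {x b y} → 1 ≤ x → x < b → b < y → y ≤ i → g b ≡ v → g x < g y → ⊥
  no-ascent-around {x} {b} {y} 1≤x x<b b<y y≤i gb≡v gx<gy
    with preimage-of-v (≤-trans 1≤x (<⇒≤ x<b)) (≤-trans (<⇒≤ b<y) y≤i) gb≡v
  ... | refl with region S (≤-trans (s≤s z≤n) (<⇒≤ b<y)) y≤i
  ...   | inj₁ (y≤1+r , _) = <⇒≱ b<y (≤-trans y≤1+r (n≤1+n _))
  ...   | inj₂ (inj₁ (z , _ , z≤d , _ , gy)) =
          <⇒≱ gx<gy (<⇒≤ (subst (_< g x) (sym gy) (≤-<-trans (+-monoʳ-≤ t z≤d) (t+d<ascending 1≤x (≤-pred x<b)))))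
  ...   | inj₂ (inj₂ (_ , gy≤t)) =
          <⇒≱ gx<gy (<⇒≤ (≤-<-trans gy≤t (≤-<-trans (m≤m+n t d) (t+d<ascending 1≤x (≤-pred x<b)))))

  safe : SafeMove i v g
  safe = record
    { larger-before = larger-before ; no-straddle = no-straddle ; no-ascent-around = no-ascent-around }

  ascending′ : ∀ {x} → 1 ≤ x → x ≤ suc (suc r) → h x ≡ v + d′ + x
  ascending′ {x} 1≤x x≤2+r with m≤n⇒m<n∨m≡n x≤2+r
  ... | inj₁ (s≤s x≤1+r) =
        trans (extend-miss confined 1≤x (≤-trans (n≤1+n x) (≤-trans (s≤s x≤1+r) 2+r≤i))
                (λ gx≡v → <-irrefl (sym gx≡v) (v<ascending 1≤x x≤1+r)))
              (trans (ascending 1≤x x≤1+r) (regroup t d′ x))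
    where regroup : ∀ t d′ x → t + suc d′ + x ≡ suc t + d′ + x
          regroup = solve-∀
  ... | inj₂ refl = trans (extend-hit confined (s≤s z≤n) 2+r≤i g[2+r]≡v) (trans (cong suc size) (regroup t r d′))
    where regroup : ∀ t r d′ → suc (t + suc r + suc d′) ≡ suc t + d′ + suc (suc r)
          regroup = solve-∀

  middle′ : ∀ {y} → 1 ≤ y → y ≤ d′ → h (suc (suc r) + y) ≡ v + y
  middle′ {y} 1≤y y≤d′ =
    subst (λ z → h z ≡ v + y) (+-suc (suc r) y)
      (trans (extend-miss confined (s≤s z≤n) 1+r+[1+y]≤i gy≢v) (trans gy (+-suc t y)))
    where
    1+r+[1+y]≤i : suc r + suc y ≤ i
    1+r+[1+y]≤i = subst (suc r + suc y ≤_) (sym (trans size (+-assoc t (suc r) d)))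
                    (m≤n⇒m≤o+n t (+-monoʳ-≤ (suc r) (s≤s y≤d′)))
    gy : g (suc r + suc y) ≡ t + suc y
    gy = middle (s≤s z≤n) (s≤s y≤d′)
    gy≢v : g (suc r + suc y) ≢ v
    gy≢v gy≡v = <-irrefl (trans (sym gy≡v) (trans gy (+-suc t y))) (s≤s (m<m+n t 1≤y))

  low′ : ∀ {x} → suc (suc r) + d′ < x → x ≤ suc i → h x ≤ v
  low′ {x} 2+r+d′<x x≤1+i with m≤n⇒m<n∨m≡n x≤1+i
  ... | inj₂ refl = ≤-reflexive (extend-new confined v)
  ... | inj₁ (s≤s x≤i) =
        subst (_≤ v) (sym (extend-miss confined 1≤x x≤i (λ gx≡v → <⇒≱ ≤-refl (subst (_≤ t) gx≡v gx≤t))))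
          (m≤n⇒m≤1+n gx≤t)
    where
    1+r+d<x : suc r + d < x
    1+r+d<x = subst (_< x) (sym (+-suc (suc r) d′)) 2+r+d′<x
    1≤x = ≤-trans (s≤s z≤n) (<⇒≤ 1+r+d<x)
    gx≤t = low 1+r+d<x x≤i

  has-one′ : Σ ℕ λ q → suc (suc r) + d′ < q × q ≤ suc i × h q ≡ 1
  has-one′ with has-one
  ... | q , 1+r+d<q , q≤i , gq≡1 =
    q , subst (_< q) (+-suc (suc r) d′) 1+r+d<q , m≤n⇒m≤1+n q≤i ,
    trans (extend-miss confined (≤-trans (s≤s z≤n) (<⇒≤ 1+r+d<q)) q≤i (λ gq≡v → v≢1 (trans (sym gq≡v) gq≡1))) gq≡1

  shape : Shape (suc i) v (suc r) d′ h
  shape = record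
    { size      = trans (cong suc size) (regroup t r d′)
    ; 1≤t       = s≤s z≤n
    ; t≡1⇒d≡0   = λ v≡1 → ⊥-elim (v≢1 v≡1)
    ; ascending = ascending′
    ; middle    = middle′
    ; low       = low′
    ; last      = extend-new confined v
    ; has-one   = has-one′
    ; confined  = extend-confined confined v≤i
    ; avoids    = extend-avoids confined v≤i safe avoids
    }
    where regroup : ∀ t r d′ → suc (t + suc r + suc d′) ≡ suc t + suc (suc r) + d′
          regroup = solve-∀

-- f_{i+1} = 1 = f_i: possible only when the permutation is 2, 3, …, i, 1, and it stays of that form.
module StayMove {i r g} (S : Shape i 1 r 0 g) where
  open Shape S
  open Confined confined

  h : ℕ → ℕ
  h = extend i 1 g

  i≡2+r : i ≡ suc (suc r)
  i≡2+r = trans size (cong suc (+-identityʳ (suc r)))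

  1≤i : 1 ≤ i
  1≤i = subst (1 ≤_) (sym i≡2+r) (s≤s z≤n)

  ascending-≢1 : ∀ {x} → 1 ≤ x → x ≤ suc r → g x ≢ 1
  ascending-≢1 1≤x x≤1+r gx≡1 = <⇒≱ 1≤x (≤-reflexive (suc-injective (trans (sym (ascending 1≤x x≤1+r)) gx≡1)))

  preimage-of-1 : ∀ {b} → 1 ≤ b → b ≤ i → g b ≡ 1 → b ≡ i
  preimage-of-1 {b} 1≤b b≤i gb≡1 with b ≤? suc r
  ... | yes b≤1+r = ⊥-elim (ascending-≢1 1≤b b≤1+r gb≡1)
  ... | no  b≰1+r = ≤-antisym b≤i (subst (_≤ b) (sym i≡2+r) (≰⇒> b≰1+r))

  no-straddle : ∀ {x y} → 1 ≤ x → x < y → y ≤ i → g x < 1 → 1 < g y → ⊥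
  no-straddle {x} 1≤x x<y y≤i gx<1 _ with x ≤? suc r
  ... | yes x≤1+r = <⇒≱ gx<1 (subst (1 ≤_) (sym (ascending 1≤x x≤1+r)) (s≤s z≤n))
  ... | no  x≰1+r = <⇒≱ (<-≤-trans x<y y≤i) (subst (_≤ x) (sym i≡2+r) (≰⇒> x≰1+r))

  safe : SafeMove i 1 g
  safe = record
    { larger-before    = larger-before
    ; no-straddle      = no-straddle
    ; no-ascent-around = λ 1≤x x<b b<y y≤i gb≡1 _ →
        <⇒≱ b<y (subst (_ ≤_) (sym (preimage-of-1 (≤-trans 1≤x (<⇒≤ x<b)) (≤-trans (<⇒≤ b<y) y≤i) gb≡1)) y≤i)
    }
    where
    larger-before : ∀ {x b} → 1 ≤ x → x < b → b ≤ i → g b ≡ 1 → 1 < g x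
    larger-before {x} 1≤x x<b b≤i gb≡1 with preimage-of-1 (≤-trans 1≤x (<⇒≤ x<b)) b≤i gb≡1
    ... | refl = subst (1 <_) (sym (ascending 1≤x (≤-pred (subst (x <_) i≡2+r x<b)))) (s≤s 1≤x)

  ascending′ : ∀ {x} → 1 ≤ x → x ≤ suc (suc r) → h x ≡ 1 + 0 + x
  ascending′ {x} 1≤x x≤2+r with m≤n⇒m<n∨m≡n x≤2+r
  ... | inj₁ (s≤s x≤1+r) =
        trans (extend-miss confined 1≤x (subst (x ≤_) (sym i≡2+r) (m≤n⇒m≤1+n x≤1+r)) (ascending-≢1 1≤x x≤1+r))
              (ascending 1≤x x≤1+r)
  ... | inj₂ refl = trans (extend-hit confined (s≤s z≤n) (≤-reflexive (sym i≡2+r)) (subst (λ z → g z ≡ 1) i≡2+r last)) (cong suc i≡2+r)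

  low′ : ∀ {x} → suc (suc r) + 0 < x → x ≤ suc i → h x ≤ 1
  low′ {x} 2+r+0<x x≤1+i with m≤n⇒m<n∨m≡n x≤1+i
  ... | inj₂ refl      = ≤-reflexive (extend-new confined 1)
  ... | inj₁ (s≤s x≤i) = ⊥-elim (<⇒≱ 2+r+0<x (subst (x ≤_) (trans i≡2+r (sym (+-identityʳ _))) x≤i))

  shape : Shape (suc i) 1 (suc r) 0 h
  shape = record
    { size      = cong suc (trans i≡2+r (cong suc (sym (+-identityʳ (suc r)))))
    ; 1≤t       = s≤s z≤n
    ; t≡1⇒d≡0   = λ _ → refl
    ; ascending = ascending′
    ; middle    = λ 1≤y y≤0 → ⊥-elim (<⇒≱ 1≤y y≤0)
    ; low       = low′
    ; last      = extend-new confined 1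
    ; has-one   = suc i , s≤s (subst (_≤ i) (sym (+-identityʳ _)) (≤-reflexive (sym i≡2+r))) , ≤-refl ,
                  extend-new confined 1
    ; confined  = extend-confined confined 1≤i
    ; avoids    = extend-avoids confined 1≤i safe avoids
    }

data Move (t d : ℕ) : ℕ → Set where
  top   : Move t d (suc (t + d))
  shift : 1 ≤ d → Move t d (suc t)
  stay  : t ≡ 1 → d ≡ 0 → Move t d t

move? : ∀ t d v → Dec (Move t d v)
move? t zero v with v ≟ suc (t + 0) | t ≟ 1 | v ≟ t
... | yes refl | _        | _        = yes top
... | no _     | yes refl | yes refl = yes (stay refl refl)
... | no ¬top  | yes t≡1  | no v≢t   = no λ { top → ¬top refl ; (stay _ _) → v≢t refl }
... | no ¬top  | no t≢1   | _        = no λ { top → ¬top refl ; (stay t≡1 _) → t≢1 t≡1 }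
move? t (suc d) v with v ≟ suc (t + suc d) | v ≟ suc t
... | yes refl | _        = yes top
... | no _     | yes refl = yes (shift (s≤s z≤n))
... | no ¬top  | no ¬shift = no λ { top → ¬top refl ; (shift _) → ¬shift refl }

-- Every other admissible value of f_{i+1} creates a 132 whose "2" is the new value.
module Forbidden {i t r d g} (S : Shape i t r d g) where
  open Shape S

  private
    occurrence-at-new : ∀ {v a b} → 1 ≤ a → a < b → b ≤ i → v ≤ i → g a < v → g a ≢ v → g b ≡ v →
                        Occurs132Below (suc i) (extend i v g) v
    occurrence-at-new {v} 1≤a a<b b≤i v≤i ga<v ga≢v gb≡v =
      _ , _ , suc i , 1≤a , a<b , s≤s b≤i , ≤-refl ,
      subst₂ _<_ (sym (extend-miss confined 1≤a (≤-trans (<⇒≤ a<b) b≤i) ga≢v)) (sym hnew) ga<v ,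
      subst₂ _<_ (sym hnew) (sym (extend-hit confined (≤-trans 1≤a (<⇒≤ a<b)) b≤i gb≡v)) (s≤s v≤i) ,
      ≤-reflexive hnew
      where hnew = extend-new confined v

    1+r+d≤i : suc r + d ≤ i
    1+r+d≤i = subst (suc r + d ≤_) (sym (trans size (+-assoc t (suc r) d))) (m≤n+m _ t)

    size′ : i ≡ t + d + suc r
    size′ = trans size (regroup t r d)
      where regroup : ∀ t r d → t + suc r + d ≡ t + d + suc r
            regroup = solve-∀

    t+d≤i : t + d ≤ i
    t+d≤i = subst (t + d ≤_) (sym size′) (m≤m+n (t + d) (suc r))

    repeat : t ≢ 1 → Occurs132Below (suc i) (extend i t g) t
    repeat t≢1 with has-one
    ... | q , 1+r+d<q , q≤i , gq≡1 =
      occurrence-at-new 1≤q q<i ≤-refl (≤-trans (m≤m+n t d) t+d≤i)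
        (subst (_< t) (sym gq≡1) 1<t) (λ gq≡t → t≢1 (trans (sym gq≡t) gq≡1)) last
      where
      1≤q = ≤-trans (s≤s z≤n) (<⇒≤ 1+r+d<q)
      1<t = ≤∧≢⇒< 1≤t (λ 1≡t → t≢1 (sym 1≡t))
      q<i = ≤∧≢⇒< q≤i (λ q≡i → t≢1 (trans (sym last) (trans (cong g (sym q≡i)) gq≡1)))

    into-middle : ∀ {y} → 1 < y → y ≤ d → Occurs132Below (suc i) (extend i (t + y) g) (t + y)
    into-middle {y} 1<y y≤d =
      occurrence-at-new (s≤s z≤n) (+-monoʳ-< (suc r) 1<y) (≤-trans (+-monoʳ-≤ (suc r) y≤d) 1+r+d≤i)
        (≤-trans (+-monoʳ-≤ t y≤d) t+d≤i) g₁<v (λ g≡ → <-irrefl g≡ g₁<v) (middle (<⇒≤ 1<y) y≤d)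
      where
      g₁<v = subst (_< t + y) (sym (middle ≤-refl (≤-trans (<⇒≤ 1<y) y≤d))) (+-monoʳ-< t 1<y)

    into-ascending : ∀ {x} → 1 < x → x ≤ suc r → Occurs132Below (suc i) (extend i (t + d + x) g) (t + d + x)
    into-ascending {x} 1<x x≤1+r =
      occurrence-at-new ≤-refl 1<x x≤i (subst (t + d + x ≤_) (sym size′) (+-monoʳ-≤ (t + d) x≤1+r))
        g₁<v (λ g≡ → <-irrefl g≡ g₁<v) (ascending (<⇒≤ 1<x) x≤1+r)
      where
      x≤i = ≤-trans x≤1+r (≤-trans (m≤m+n (suc r) d) 1+r+d≤i)
      g₁<v = subst (_< t + d + x) (sym (ascending ≤-refl (s≤s z≤n))) (+-monoʳ-< (t + d) 1<x)

    within-middle : ∀ {y} → t < t + y → t + y ≤ t + d → ¬ Move t d (t + y) →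
                    Occurs132Below (suc i) (extend i (t + y) g) (t + y)
    within-middle {y} t<t+y t+y≤t+d ¬move = into-middle 1<y y≤d
      where
      y≤d = +-cancelˡ-≤ t y d t+y≤t+d
      1≤y = +-cancelˡ-≤ t 1 y (subst (_≤ t + y) (+-comm 1 t) t<t+y)
      1<y = ≤∧≢⇒< 1≤y λ 1≡y →
        ¬move (subst (Move t d) (trans (+-comm 1 t) (cong (t +_) 1≡y)) (shift (≤-trans 1≤y y≤d)))

    above-middle : ∀ {x} → t + d < t + d + x → t + d + x ≤ i → ¬ Move t d (t + d + x) →
                   Occurs132Below (suc i) (extend i (t + d + x) g) (t + d + x)
    above-middle {x} t+d<v v≤i ¬move = into-ascending 1<x x≤1+r
      where
      1≤x = +-cancelˡ-≤ (t + d) 1 x (subst (_≤ t + d + x) (+-comm 1 (t + d)) t+d<v)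
      1<x = ≤∧≢⇒< 1≤x λ 1≡x → ¬move (subst (Move t d) (trans (+-comm 1 (t + d)) (cong (t + d +_) 1≡x)) top)
      x≤1+r = +-cancelˡ-≤ (t + d) x (suc r) (subst (t + d + x ≤_) size′ v≤i)

  creates-132 : ∀ {v} → ¬ Move t d v → t ≤ v → v ≤ i → Occurs132Below (suc i) (extend i v g) v
  creates-132 {v} ¬move t≤v v≤i with m≤n⇒m<n∨m≡n t≤v
  ... | inj₂ refl = repeat (λ t≡1 → ¬move (stay t≡1 (t≡1⇒d≡0 t≡1)))
  ... | inj₁ t<v with v ≤? t + d
  ...   | yes v≤t+d with m≤n⇒∃[o]m+o≡n t≤v
  ...     | _ , refl = within-middle t<v v≤t+d ¬move
  creates-132 {v} ¬move t≤v v≤i | inj₁ t<v | no v≰t+d with m≤n⇒∃[o]m+o≡n (<⇒≤ (≰⇒> v≰t+d))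
  ...     | _ , refl = above-middle (≰⇒> v≰t+d) v≤i ¬move

mutual
  suffixes : (t r d m : ℕ) → List (Vec ℕ m)
  suffixes t r d zero    = [] ∷ []
  suffixes t r d (suc m) = topSuffixes t r d m ++ shiftSuffixes t r d m ++ staySuffixes t r d m

  topSuffixes : (t r d m : ℕ) → List (Vec ℕ (suc m))
  topSuffixes t r d m = L.map (suc (t + d) ∷_) (suffixes (suc (t + d)) 0 r m)

  shiftSuffixes : (t r d m : ℕ) → List (Vec ℕ (suc m))
  shiftSuffixes t r zero    m = []
  shiftSuffixes t r (suc d) m = L.map (suc t ∷_) (suffixes (suc t) (suc r) d m)

  staySuffixes : (t r d m : ℕ) → List (Vec ℕ (suc m))
  staySuffixes 1 r 0 m = L.map (1 ∷_) (suffixes 1 (suc r) 0 m)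
  staySuffixes _ _ _ _ = []

vec-map∷-decomp∈ : ∀ {m w v} {s : Vec ℕ m} {ss} → (v ∷ s) ∈ L.map (w ∷_) ss → v ≡ w × s ∈ ss
vec-map∷-decomp∈ v∷s∈ with _ , s∈ , eq ← ∈-map⁻ _ v∷s∈ with refl , refl ← ∷-injective eq = refl , s∈

shiftSuffixes⁻ : ∀ {t r d m x} → x ∈ shiftSuffixes t r d m →
                 Σ ℕ λ d′ → d ≡ suc d′ × x ∈ L.map (suc t ∷_) (suffixes (suc t) (suc r) d′ m)
shiftSuffixes⁻ {d = suc d′} x∈ = d′ , refl , x∈

staySuffixes⁻ : ∀ {t r d m x} → x ∈ staySuffixes t r d m →
                t ≡ 1 × d ≡ 0 × x ∈ L.map (1 ∷_) (suffixes 1 (suc r) 0 m)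
staySuffixes⁻ {1} {d = 0} x∈ = refl , refl , x∈
staySuffixes⁻ {0} ()
staySuffixes⁻ {1} {d = suc _} ()
staySuffixes⁻ {suc (suc _)} ()

avoids-+-suc : ∀ {i m σ} → Avoids132 (suc i + m) σ → Avoids132 (i + suc m) σ
avoids-+-suc {i} {m} {σ} = subst (λ k → Avoids132 k σ) (sym (+-suc i m))

avoids-+-suc⁻ : ∀ {i m σ} → Avoids132 (i + suc m) σ → Avoids132 (suc i + m) σ
avoids-+-suc⁻ {i} {m} {σ} = subst (λ k → Avoids132 k σ) (+-suc i m)

suffixes-sound : ∀ {m i t r d g} {s : Vec ℕ m} → Shape i t r d g → s ∈ suffixes t r d m →
                 ValidSuffix i t s × Avoids132 (i + m) (extendBy i s g)
suffixes-sound {zero} {i} {g = g} {[]} S (here refl) =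
  tt , subst (λ k → Avoids132 k g) (sym (+-identityʳ i)) (Shape.avoids S)
suffixes-sound {suc m} {i} {t} {r} {d} {s = v ∷ s} S v∷s∈ with ∈-++⁻ (topSuffixes t r d m) v∷s∈
... | inj₁ top∈ with refl , s∈ ← vec-map∷-decomp∈ top∈ with valid , av ← suffixes-sound (TopMove.shape S) s∈ =
  (≤-trans (m≤m+n t d) (n≤1+n _) , TopMove.v≤i S , valid) , avoids-+-suc av
... | inj₂ rest∈ with ∈-++⁻ (shiftSuffixes t r d m) rest∈
...   | inj₁ shift∈ with d′ , refl , shift∈′ ← shiftSuffixes⁻ {t} {r} {d} shift∈ with refl , s∈ ← vec-map∷-decomp∈ shift∈′
        with valid , av ← suffixes-sound (ShiftMove.shape S) s∈ =
  (n≤1+n t , ShiftMove.v≤i S , valid) , avoids-+-suc av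
...   | inj₂ stay∈ with refl , refl , stay∈′ ← staySuffixes⁻ {t} {r} {d} stay∈ with refl , s∈ ← vec-map∷-decomp∈ stay∈′
        with valid , av ← suffixes-sound (StayMove.shape S) s∈ =
  (≤-refl , StayMove.1≤i S , valid) , avoids-+-suc av

suffixes-complete : ∀ {m i t r d g} (s : Vec ℕ m) → Shape i t r d g → ValidSuffix i t s →
                    Avoids132 (i + m) (extendBy i s g) → s ∈ suffixes t r d m
suffixes-complete [] S _ _ = here refl
suffixes-complete {suc m} {i} {t} {r} {d} {g} (v ∷ s) S (t≤v , v≤i , valid) av with move? t d v
... | yes top = ∈-++⁺ˡ (∈-map⁺ _ (suffixes-complete s (TopMove.shape S) valid (avoids-+-suc⁻ av)))
... | yes (shift (s≤s z≤n)) =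
  ∈-++⁺ʳ (topSuffixes t r d m) (∈-++⁺ˡ (∈-map⁺ _ (suffixes-complete s (ShiftMove.shape S) valid (avoids-+-suc⁻ av))))
... | yes (stay refl refl) =
  ∈-++⁺ʳ (topSuffixes 1 r 0 m) (∈-++⁺ʳ [] (∈-map⁺ _ (suffixes-complete s (StayMove.shape S) valid (avoids-+-suc⁻ av))))
... | no ¬move = ⊥-elim (avoids-+-suc⁻ av
        (132-persists s (extend-confined (Shape.confined S) v≤i) valid (Forbidden.creates-132 S ¬move t≤v v≤i)))

suffixes-unique : ∀ t r d m → Unique (suffixes t r d m)
suffixes-unique t r d zero    = All.[] ∷ []
suffixes-unique t r d (suc m) =
  ++⁺ (map⁺ ∷-injectiveʳ (suffixes-unique _ _ _ m)) (++⁺ (shift-unique d) (stay-unique t d) shift∉stay) top∉rest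
  where
  shift-unique : ∀ d → Unique (shiftSuffixes t r d m)
  shift-unique zero    = []
  shift-unique (suc d) = map⁺ ∷-injectiveʳ (suffixes-unique _ _ _ m)
  stay-unique : ∀ t d → Unique (staySuffixes t r d m)
  stay-unique 1             0       = map⁺ ∷-injectiveʳ (suffixes-unique _ _ _ m)
  stay-unique 0             _       = []
  stay-unique 1             (suc _) = []
  stay-unique (suc (suc _)) _       = []
  shift∉stay : ∀ {x} → ¬ (x ∈ shiftSuffixes t r d m × x ∈ staySuffixes t r d m)
  shift∉stay (shift∈ , stay∈)
    with _ , refl , _ ← shiftSuffixes⁻ {t} {r} {d} shift∈ | _ , () , _ ← staySuffixes⁻ {t} {r} {d} stay∈
  top∉rest : ∀ {x} → ¬ (x ∈ topSuffixes t r d m × x ∈ shiftSuffixes t r d m ++ staySuffixes t r d m)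
  top∉rest {v ∷ _} (top∈ , rest∈) with refl , _ ← vec-map∷-decomp∈ top∈ | ∈-++⁻ (shiftSuffixes t r d m) rest∈
  ... | inj₁ shift∈ with d′ , refl , shift∈′ ← shiftSuffixes⁻ {t} {r} {d} shift∈ with e , _ ← vec-map∷-decomp∈ shift∈′ =
        m≢1+m+n t (trans (sym (suc-injective e)) (+-suc t d′))
  ... | inj₂ stay∈ with refl , refl , stay∈′ ← staySuffixes⁻ {t} {r} {d} stay∈ with () , _ ← vec-map∷-decomp∈ stay∈′

mutual
  partitions : (r d m : ℕ) → List (List ℕ)
  partitions r d zero    = (suc r ∷ []) ∷ []
  partitions r d (suc m) = L.map (suc r ∷_) (partitions 0 r m) ++ largerHead r d m

  largerHead : (r d m : ℕ) → List (List ℕ)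
  largerHead r zero    m = []
  largerHead r (suc d) m = partitions (suc r) d m

HeadIn : ℕ → ℕ → List ℕ → Set
HeadIn lo hi λs = Σ ℕ λ h → Σ (List ℕ) λ μ → λs ≡ h ∷ μ × lo ≤ h × h ≤ hi

cons-partition : ∀ h {n μ} → IsPartition n μ → HeadIn 1 h μ → IsPartition (h + n) (h ∷ μ)
cons-partition h (linked , positive , refl) (_ , _ , refl , 1≤h′ , h′≤h) =
  h′≤h Linked.∷ linked , ≤-trans 1≤h′ h′≤h All.∷ positive , refl

partitions-sound : ∀ r d m {λs} → λs ∈ partitions r d m →
                   IsPartition (suc r + m) λs × HeadIn (suc r) (suc r + d) λs
partitions-sound r d zero (here refl) =
  ([-] , s≤s z≤n All.∷ All.[] , refl) , (suc r , [] , refl , ≤-refl , m≤m+n (suc r) d)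
partitions-sound r d (suc m) {λs} λs∈ with ∈-++⁻ (L.map (suc r ∷_) (partitions 0 r m)) λs∈
partitions-sound r d (suc m) {λs} λs∈ | inj₁ small∈ with _ , μ∈ , refl ← ∈-map⁻ _ small∈
  with part , head ← partitions-sound 0 r m μ∈ =
  cons-partition (suc r) part head , (suc r , _ , refl , ≤-refl , m≤m+n (suc r) d)
partitions-sound r (suc d) (suc m) λs∈ | inj₂ large∈
  with (linked , positive , sum≡) , (h , μ , eq , lo , hi) ← partitions-sound (suc r) d m large∈ =
  (linked , positive , trans sum≡ (sym (+-suc (suc r) m))) ,
  (h , μ , eq , ≤-trans (n≤1+n _) lo , subst (h ≤_) (sym (+-suc (suc r) d)) hi)

sum≡0⇒[] : ∀ {xs} → All (1 ≤_) xs → sum xs ≡ 0 → xs ≡ []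
sum≡0⇒[] All.[]                    _    = refl
sum≡0⇒[] {x ∷ _} (1≤x All.∷ _) sum≡0 = ⊥-elim (<⇒≱ 1≤x (≤-reflexive (m+n≡0⇒m≡0 x sum≡0)))

head≤sum : ∀ h μ → h ≤ sum (h ∷ μ)
head≤sum h μ = m≤m+n h (sum μ)

partition⇒HeadIn : ∀ {n λs} → IsPartition (suc n) λs → HeadIn 1 (suc n) λs
partition⇒HeadIn {λs = h ∷ μ} (_ , 1≤h All.∷ _ , sum≡) = h , μ , refl , 1≤h , subst (h ≤_) sum≡ (head≤sum h μ)

tail-HeadIn : ∀ {h μ n} → Linked (λ x y → y ≤ x) (h ∷ μ) → All (1 ≤_) μ → sum μ ≡ suc n → HeadIn 1 h μ
tail-HeadIn {μ = h′ ∷ μ′} linked (1≤h′ All.∷ _) _ = h′ , μ′ , refl , 1≤h′ , Linked.head linked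

partitions-complete : ∀ r d m λs → IsPartition (suc r + m) λs → HeadIn (suc r) (suc r + d) λs →
                      λs ∈ partitions r d m
partitions-complete r d zero _ (linked , positive , sum≡) (h , μ , refl , lo , hi)
  with refl ← ≤-antisym (subst (h ≤_) (trans sum≡ (+-identityʳ _)) (head≤sum h μ)) lo
  with refl ← sum≡0⇒[] (All.tail positive) (+-cancelˡ-≡ _ (sum μ) 0 sum≡) = here refl
partitions-complete r d (suc m) _ (linked , positive , sum≡) (h , μ , refl , lo , hi) with h ≟ suc r
... | yes refl = ∈-++⁺ˡ (∈-map⁺ _ (partitions-complete 0 r m μ (Linked.tail linked , All.tail positive , sum-μ)
                                    (tail-HeadIn linked (All.tail positive) sum-μ)))
  where sum-μ = +-cancelˡ-≡ (suc r) (sum μ) (suc m) sum≡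
... | no h≢1+r = larger d hi
  where
  1+r<h = ≤∧≢⇒< lo (λ 1+r≡h → h≢1+r (sym 1+r≡h))
  larger : ∀ d → h ≤ suc r + d → (h ∷ μ) ∈ partitions r d (suc m)
  larger zero    h≤1+r+0   = ⊥-elim (<⇒≱ 1+r<h (subst (h ≤_) (+-identityʳ _) h≤1+r+0))
  larger (suc d) h≤1+r+1+d = ∈-++⁺ʳ (L.map (suc r ∷_) (partitions 0 r m))
    (partitions-complete (suc r) d m (h ∷ μ) (linked , positive , trans sum≡ (+-suc (suc r) m))
      (h , μ , refl , 1+r<h , subst (h ≤_) (+-suc (suc r) d) h≤1+r+1+d))

partitions-unique : ∀ r d m → Unique (partitions r d m)
partitions-unique r d zero    = All.[] ∷ []
partitions-unique r d (suc m) = ++⁺ (map⁺ List.∷-injectiveʳ (partitions-unique 0 r m)) (larger-unique d) (disjoint d)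
  where
  larger-unique : ∀ d → Unique (largerHead r d m)
  larger-unique zero    = []
  larger-unique (suc d) = partitions-unique (suc r) d m
  disjoint : ∀ d {λs} → ¬ (λs ∈ L.map (suc r ∷_) (partitions 0 r m) × λs ∈ largerHead r d m)
  disjoint zero    (_ , ())
  disjoint (suc d) {[]}    (small∈ , _) = []∉map∷ small∈
  disjoint (suc d) {h ∷ _} (small∈ , large∈)
    with refl , _ ← map∷-decomp∈ small∈ | _ , (_ , _ , refl , 2+r≤h , _) ← partitions-sound (suc r) d m large∈ =
    1+n≰n 2+r≤h

length-++-cong : ∀ {A B : Set} (xs : List A) {ys} (us : List B) {vs} →
                 L.length xs ≡ L.length us → L.length ys ≡ L.length vs →
                 L.length (xs ++ ys) ≡ L.length (us ++ vs)
length-++-cong xs us xs≈us ys≈vs =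
  trans (List.length-++ xs) (trans (cong₂ _+_ xs≈us ys≈vs) (sym (List.length-++ us)))

length-map-cong : ∀ {A B C D : Set} {f : A → B} {g : C → D} xs us →
                  L.length xs ≡ L.length us → L.length (L.map f xs) ≡ L.length (L.map g us)
length-map-cong {f = f} {g} xs us xs≈us =
  trans (List.length-map f xs) (trans xs≈us (sym (List.length-map g us)))

length-suffixes : ∀ t r d m → 2 ≤ t → L.length (suffixes t r d m) ≡ L.length (partitions r d m)
length-suffixes t r d zero    _   = refl
length-suffixes t r d (suc m) 2≤t =
  length-++-cong (topSuffixes t r d m) (L.map (suc r ∷_) (partitions 0 r m))
    (length-map-cong (suffixes (suc (t + d)) 0 r m) (partitions 0 r m)
      (length-suffixes _ 0 r m (s≤s (≤-trans (≤-trans (n≤1+n 1) 2≤t) (m≤m+n t d)))))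
    (trans (length-++-cong (shiftSuffixes t r d m) (largerHead r d m) (length-larger d) (no-stay t 2≤t))
           (cong L.length (List.++-identityʳ (largerHead r d m))))
  where
  length-larger : ∀ d → L.length (shiftSuffixes t r d m) ≡ L.length (largerHead r d m)
  length-larger zero    = refl
  length-larger (suc d) =
    trans (List.length-map (suc t ∷_) (suffixes (suc t) (suc r) d m))
          (length-suffixes (suc t) (suc r) d m (m≤n⇒m≤1+n 2≤t))
  no-stay : ∀ t → 2 ≤ t → L.length (staySuffixes t r d m) ≡ L.length {A = List ℕ} []
  no-stay (suc (suc _)) _        = refl
  no-stay (suc zero)    (s≤s ())

length-suffixes-from-1 : ∀ r m → L.length (suffixes 1 r 0 m) ≡ L.length (partitions r m m)
length-suffixes-from-1 r zero    = refl
length-suffixes-from-1 r (suc m) =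
  length-++-cong (topSuffixes 1 r 0 m) (L.map (suc r ∷_) (partitions 0 r m))
    (length-map-cong (suffixes 2 0 r m) (partitions 0 r m) (length-suffixes 2 0 r m ≤-refl))
    (trans (List.length-map (1 ∷_) (suffixes 1 (suc r) 0 m)) (length-suffixes-from-1 (suc r) m))

zip-applyUpTo≡swapsFrom : ∀ (f : ℕ → ℕ) k {n} (s : Vec ℕ n) → (∀ x → f x ≡ k + x) →
                          zip (applyUpTo f n) (toList s) ≡ swapsFrom k (toList s)
zip-applyUpTo≡swapsFrom f k []      _ = refl
zip-applyUpTo≡swapsFrom f k (v ∷ s) f≗k+ =
  cong₂ _∷_ (cong (_, v) (trans (f≗k+ 0) (+-identityʳ k)))
              (zip-applyUpTo≡swapsFrom (f ∘ suc) (suc k) s (λ x → trans (f≗k+ (suc x)) (+-suc k x)))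

φ≗extendBy : ∀ {n} (f : Vec ℕ n) x → φ f x ≡ extendBy 0 f id x
φ≗extendBy {n} f x = cong (λ swaps → applySwaps swaps x)
  (trans (cong (λ ks → zip ks (toList f)) (List.map-upTo suc n)) (zip-applyUpTo≡swapsFrom suc 1 f (λ _ → refl)))

avoids-cong : ∀ {n σ τ} → (∀ x → σ x ≡ τ x) → Avoids132 n σ → Avoids132 n τ
avoids-cong σ≗τ av (a , b , c , 1≤a , a<b , b<c , c≤n , p , q) =
  av (a , b , c , 1≤a , a<b , b<c , c≤n , subst₂ _<_ (sym (σ≗τ a)) (sym (σ≗τ c)) p ,
      subst₂ _<_ (sym (σ≗τ c)) (sym (σ≗τ b)) q)

-- φ(11) = 21, the permutation every f counted by d_n starts with.
φ₁₁ : ℕ → ℕ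
φ₁₁ = extendBy 0 (1 ∷ 1 ∷ []) id

shape-φ₁₁ : Shape 2 1 0 0 φ₁₁
shape-φ₁₁ = record
  { size      = refl
  ; 1≤t       = ≤-refl
  ; t≡1⇒d≡0   = λ _ → refl
  ; ascending = λ { {1} _ _ → refl ; {suc (suc _)} _ (s≤s ()) }
  ; middle    = λ 1≤y y≤0 → ⊥-elim (<⇒≱ 1≤y y≤0)
  ; low       = λ { {1} (s≤s ()) _ ; {2} _ _ → ≤-refl ; {suc (suc (suc _))} _ (s≤s (s≤s ())) }
  ; last      = refl
  ; has-one   = 2 , ≤-refl , ≤-refl , refl
  ; confined  = record { bounded = bounded ; fixed = fixed }
  ; avoids    = λ { (a , b , c , 1≤a , a<b , b<c , c≤2 , _) →
                    <⇒≱ (≤-trans (s≤s (≤-trans (s≤s 1≤a) a<b)) b<c) c≤2 }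
  }
  where
  bounded : ∀ {x} → 1 ≤ x → x ≤ 2 → φ₁₁ x ≤ 2
  bounded {1} _ _ = ≤-refl
  bounded {2} _ _ = s≤s z≤n
  bounded {suc (suc (suc _))} _ (s≤s (s≤s ()))
  fixed : ∀ {x} → 2 < x → φ₁₁ x ≡ x
  fixed {1}                 (s≤s ())
  fixed {2}                 (s≤s (s≤s ()))
  fixed {suc (suc (suc _))} _ = refl

ValidSuffix⇒ : ∀ {m} i w (s : Vec ℕ m) → ValidSuffix i w s →
               (∀ k → w ≤ lookup s k) × (∀ k → lookup s k ≤ i + toℕ k) × NonDecreasing s
ValidSuffix⇒ i w []      _                 = (λ ()) , (λ ()) , (λ ())
ValidSuffix⇒ i w (v ∷ s) (w≤v , v≤i , valid) with from≥ , ≤bound , mono ← ValidSuffix⇒ (suc i) v s valid =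
  from≥′ , ≤bound′ , mono′
  where
  from≥′ : ∀ k → w ≤ lookup (v ∷ s) k
  from≥′ fzero    = w≤v
  from≥′ (fsuc k) = ≤-trans w≤v (from≥ k)
  ≤bound′ : ∀ k → lookup (v ∷ s) k ≤ i + toℕ k
  ≤bound′ fzero    = subst (v ≤_) (sym (+-identityʳ i)) v≤i
  ≤bound′ (fsuc k) = subst (lookup s k ≤_) (sym (+-suc i (toℕ k))) (≤bound k)
  mono′ : NonDecreasing (v ∷ s)
  mono′ fzero    fzero    _       = ≤-refl
  mono′ fzero    (fsuc l) _       = from≥ l
  mono′ (fsuc k) (fsuc l) (s≤s p) = mono k l p

⇒ValidSuffix : ∀ {m} i w (s : Vec ℕ m) →
               (∀ k → w ≤ lookup s k) → (∀ k → lookup s k ≤ i + toℕ k) → NonDecreasing s → ValidSuffix i w s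
⇒ValidSuffix i w []      _ _ _ = tt
⇒ValidSuffix i w (v ∷ s) from≥ ≤bound mono =
  from≥ fzero , subst (v ≤_) (+-identityʳ i) (≤bound fzero) ,
  ⇒ValidSuffix (suc i) v s (λ k → mono fzero (fsuc k) z≤n)
    (λ k → subst (lookup s k ≤_) (+-suc i (toℕ k)) (≤bound (fsuc k))) (λ k l p → mono (fsuc k) (fsuc l) (s≤s p))

D-list : ∀ m → List (Vec ℕ (2 + m))
D-list m = L.map (λ s → 1 ∷ 1 ∷ s) (suffixes 1 0 0 m)

D-list-sound : ∀ m (f : Vec ℕ (2 + m)) → f ∈ D-list m → IsD (2 + m) f
D-list-sound m f f∈ with s , s∈ , refl ← ∈-map⁻ _ f∈ with valid , av ← suffixes-sound shape-φ₁₁ s∈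
  with from≥ , ≤bound , mono ← ValidSuffix⇒ 2 1 s valid =
  subexceedant , nondecreasing , no-fixed-points , avoids-cong (λ x → sym (φ≗extendBy (1 ∷ 1 ∷ s) x)) av
  where
  subexceedant : Subexceedant (1 ∷ 1 ∷ s)
  subexceedant fzero               = ≤-refl , ≤-refl
  subexceedant (fsuc fzero)        = ≤-refl , s≤s z≤n
  subexceedant (fsuc (fsuc k))     = from≥ k , ≤-trans (≤bound k) (n≤1+n _)
  nondecreasing : NonDecreasing (1 ∷ 1 ∷ s)
  nondecreasing fzero           fzero           _ = ≤-refl
  nondecreasing fzero           (fsuc fzero)    _ = ≤-refl
  nondecreasing fzero           (fsuc (fsuc l)) _ = from≥ l
  nondecreasing (fsuc fzero)    (fsuc fzero)    _ = ≤-refl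
  nondecreasing (fsuc fzero)    (fsuc (fsuc l)) _ = from≥ l
  nondecreasing (fsuc (fsuc k)) (fsuc (fsuc l)) (s≤s (s≤s p)) = mono k l p
  no-fixed-points : NoFixedPointsExceptOne (1 ∷ 1 ∷ s)
  no-fixed-points (fsuc fzero)    _ ()
  no-fixed-points (fsuc (fsuc k)) _ fk≡k = 1+n≰n (subst (_≤ 2 + toℕ k) fk≡k (≤bound k))

D-list-complete : ∀ m (f : Vec ℕ (2 + m)) → IsD (2 + m) f → f ∈ D-list m
D-list-complete m (f₁ ∷ f₂ ∷ s) (subexceedant , nondecreasing , no-fixed-points , av)
  with 1≤f₁ , f₁≤1 ← subexceedant fzero | 1≤f₂ , f₂≤2 ← subexceedant (fsuc fzero)
  with refl ← ≤-antisym f₁≤1 1≤f₁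
  with refl ← ≤-antisym (≤-pred (≤∧≢⇒< f₂≤2 (no-fixed-points (fsuc fzero) ≤-refl))) 1≤f₂ =
  ∈-map⁺ _ (suffixes-complete s shape-φ₁₁ valid (avoids-cong (φ≗extendBy (1 ∷ 1 ∷ s)) av))
  where
  ≤bound : ∀ k → lookup s k ≤ 2 + toℕ k
  ≤bound k = ≤-pred (≤∧≢⇒< (proj₂ (subexceedant (fsuc (fsuc k)))) (no-fixed-points (fsuc (fsuc k)) (s≤s z≤n)))
  valid : ValidSuffix 2 1 s
  valid = ⇒ValidSuffix 2 1 s (λ k → nondecreasing (fsuc fzero) (fsuc (fsuc k)) (s≤s z≤n)) ≤bound
            (λ k l p → nondecreasing (fsuc (fsuc k)) (fsuc (fsuc l)) (s≤s (s≤s p)))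

D-count : ∀ m → HasCount (IsD (2 + m)) (L.length (partitions 0 m m))
D-count m =
  D-list m , map⁺ (∷-injectiveʳ ∘ ∷-injectiveʳ) (suffixes-unique 1 0 0 m) ,
  (λ f → mk⇔ (D-list-sound m f) (D-list-complete m f)) ,
  trans (List.length-map _ (suffixes 1 0 0 m)) (length-suffixes-from-1 0 m)

partition-count : ∀ m → HasCount (IsPartition (suc m)) (L.length (partitions 0 m m))
partition-count m =
  partitions 0 m m , partitions-unique 0 m m ,
  (λ λs → mk⇔ (proj₁ ∘ partitions-sound 0 m m) (λ p → partitions-complete 0 m m λs p (partition⇒HeadIn p))) ,
  refl

D₁-count : HasCount (IsD 1) 1
D₁-count = (1 ∷ []) ∷ [] , All.[] ∷ [] , (λ f → mk⇔ sound complete) , refl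
  where
  sound : ∀ {f} → f ∈ (1 ∷ []) ∷ [] → IsD 1 f
  sound (here refl) =
    (λ { fzero → ≤-refl , ≤-refl }) , (λ { fzero fzero _ → ≤-refl }) , (λ { fzero () }) ,
    λ { (a , b , c , 1≤a , a<b , b<c , c≤1 , _) → <⇒≱ (≤-trans (s≤s (≤-trans (s≤s 1≤a) a<b)) b<c) (m≤n⇒m≤1+n c≤1) }
  complete : ∀ {f} → IsD 1 f → f ∈ (1 ∷ []) ∷ []
  complete {f₁ ∷ []} (subexceedant , _) with 1≤f₁ , f₁≤1 ← subexceedant fzero with refl ← ≤-antisym f₁≤1 1≤f₁ =
    here refl

partitions₀-count : HasCount (IsPartition 0) 1
partitions₀-count = [] ∷ [] , All.[] ∷ [] , (λ λs → mk⇔ sound complete) , refl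
  where
  sound : ∀ {λs} → λs ∈ [] ∷ [] → IsPartition 0 λs
  sound (here refl) = Linked.[] , All.[] , refl
  complete : ∀ {λs} → IsPartition 0 λs → λs ∈ [] ∷ []
  complete (_ , positive , sum≡0) with refl ← sum≡0⇒[] positive sum≡0 = here refl

corollary5p1 : ∀ (n : ℕ) → 1 ≤ n →
    Σ ℕ λ k → HasCount (IsD n) k × HasCount (IsPartition (n ∸ 1)) k
corollary5p1 0             ()
corollary5p1 1             _ = 1 , D₁-count , partitions₀-count
corollary5p1 (suc (suc m)) _ = L.length (partitions 0 m m) , D-count m , partition-count m
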